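{- Let $\rho\in[0,1]$, let $G$ be a graph, let $S\subseteq V(G)$ and let $G'=G-S$ be the subgraph of $G$ induced by $V(G)\setminus S$. If $A\subseteq V(G')$ is a contagious set for $G'$ with respect to $\rho$, then $A\cup S$ is a contagious set for $G$ with respect to $\rho$.
   Context: All graphs are finite and simple. For a graph $G$, a constant $\rho\in[0,1]$ and a set $A\subseteq V(G)$, define the infecting sequence by $A_0:=A$ and $A_{i+1}:=A_i\cup\{v\in V(G): |N_G(v)\cap A_i|\geq \rho\, d_G(v)\}$, where $N_G(v)$ is the neighbourhood and $d_G(v)$ the degree of $v$ in $G$. Since $G$ is finite the sequence stabilises; the final set is denoted $H_{\rho,G}(A)$. A set $A$ is a contagious set for $G$ (with respect to $\rho$) if $H_{\rho,G}(A)=V(G)$.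
   Formalization: The constant ρ ranges over the rationals in $[0,1]$. -}

module Defs where

open import Data.Nat using (ℕ; zero; suc)
open import Data.Integer using (+_)
open import Data.Bool using (Bool; true; false; if_then_else_; _∧_)
open import Data.Fin.Subset.Properties using (_∈?_)
open import Relation.Nullary.Decidable using (⌊_⌋)
open import Data.Fin using (Fin)
open import Data.Fin.Subset using (Subset; _∈_; _∉_; _∩_; _∪_; _⊆_; ∣_∣; ∁; ⊤)
open import Data.Vec using (tabulate)
open import Data.Rational using (ℚ; _/_; _*_; _≤_; _≤ᵇ_)
open import Data.Product using (∃)
open import Relation.Binary.PropositionalEquality using (_≡_)

record Graph (n : ℕ) : Set where
  field
    adj     : Fin n → Fin n → Bool
    adj-sym : ∀ u v → adj u v ≡ adj v u
    irrefl  : ∀ v → adj v v ≡ false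
open Graph public

N : ∀ {n} → Graph n → Fin n → Subset n
N G v = tabulate λ u → if adj G v u then Data.Fin.Subset.inside else Data.Fin.Subset.outside

⟦_⟧ : ℕ → ℚ
⟦ k ⟧ = + k / 1

-- The induced subgraph G[W] (vertex set W ⊆ V(G)) is represented by the pair (G , W):
-- for v ∈ W, its neighbourhood in G[W] is N_G(v) ∩ W and its degree is |N_G(v) ∩ W|.
degIn : ∀ {n} → Graph n → Subset n → Fin n → ℕ
degIn G W v = ∣ N G v ∩ W ∣

_∈ᵇ_ : ∀ {n} → Fin n → Subset n → Bool
v ∈ᵇ X = ⌊ v ∈? X ⌋

step : ∀ {n} → ℚ → Graph n → Subset n → Subset n → Subset n
step {n} ρ G W A = A ∪ tabulate λ v →
  if (v ∈ᵇ W) ∧ (ρ * ⟦ degIn G W v ⟧ ≤ᵇ ⟦ ∣ N G v ∩ W ∩ A ∣ ⟧)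
  then Data.Fin.Subset.inside else Data.Fin.Subset.outside

infSeq : ∀ {n} → ℚ → Graph n → Subset n → Subset n → ℕ → Subset n
infSeq ρ G W A zero    = A
infSeq ρ G W A (suc i) = step ρ G W (infSeq ρ G W A i)

-- A is contagious for G[W] w.r.t. ρ: the (monotone, eventually stable) infecting
-- sequence eventually contains all of V(G[W]) = W, i.e. H_{ρ,G[W]}(A) = W.
Contagious : ∀ {n} → ℚ → Graph n → Subset n → Subset n → Set
Contagious ρ G W A = ∃ λ i → W ⊆ infSeq ρ G W A i

ContagiousG : ∀ {n} → ℚ → Graph n → Subset n → Set
ContagiousG ρ G A = Contagious ρ G ⊤ A

{-# OPTIONS --safe #-}
-- Compare the infecting sequence A₀ ⊆ A₁ ⊆ … of G − S started from A with the
-- sequence B₀ ⊆ B₁ ⊆ … of G started from A ∪ S; by induction Aᵢ ∪ S ⊆ Bᵢ.  If v ∉ S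
-- joins Aᵢ₊₁ then ρ d_{G−S}(v) ≤ |N(v) ∖ S ∩ Aᵢ|.  In G, v has the |N(v) ∩ S| extra
-- neighbours, all of which lie in Bᵢ; adding this number to both sides keeps the
-- inequality because ρ ≤ 1, so ρ d_G(v) ≤ |N(v) ∩ Bᵢ| and v joins Bᵢ₊₁.
module Submission where

open import Defs
open import Data.Nat using (ℕ)
open import Data.Rational using (ℚ; 0ℚ; 1ℚ; _≤_)
open import Data.Fin.Subset using (Subset; _⊆_; _∪_; ∁)

open import Data.Bool using (Bool; true; false; T; if_then_else_; _∧_)
open import Data.Bool.Properties using (T-≡; T-∧)
open import Data.Fin using (Fin)
open import Data.Fin.Subset using (_∈_; _∩_; ⊤; ∣_∣; inside; outside)
open import Data.Fin.Subset.Properties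
  using (_∈?_; ∈⊤; x∈p∩q⁺; x∈p∩q⁻; x∈p∪q⁺; x∈p∪q⁻; p⊆p∪q; q⊆p∪q; x∉p⇒x∈∁p;
         p⊆q⇒∣p∣≤∣q∣; ∩-identityʳ)
import Data.Integer as ℤ
import Data.Integer.Properties as ℤ
import Data.Nat as ℕ
import Data.Nat.Coprimality as Coprimality
import Data.Nat.Properties as ℕ
open import Data.Product using (_×_; _,_; map)
open import Data.Rational using (mkℚ; _+_; _*_; _/_; NonNegative; _≤ᵇ_; *≤*)
open import Data.Rational.Properties
  using (normalize-coprime; normalize-nonNeg; *-distribˡ-+; *-identityˡ; +-monoˡ-≤;
         +-monoʳ-≤; *-monoʳ-≤-nonNeg; ≤ᵇ⇒≤; ≤⇒≤ᵇ; module ≤-Reasoning)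
open import Data.Sum using (_⊎_; inj₁; inj₂; map₂; [_,_]′)
open import Data.Vec using (_∷_; []; tabulate; lookup)
open import Data.Vec.Properties using (lookup∘tabulate; []=⇒lookup; lookup⇒[]=)
open import Function using (id; _∘_; _⇔_; Equivalence; mk⇔)
open import Relation.Binary.PropositionalEquality using (_≡_; refl; sym; trans; cong; cong₂)
open import Relation.Nullary using (yes; no)
open import Relation.Nullary.Decidable using (toWitness; fromWitness)

private
  variable
    n : ℕ
    a b : ℕ
    ρ : ℚ
    G : Graph n
    W S A B : Subset n
    v : Fin n

⟦⟧≡mkℚ : ∀ k → ⟦ k ⟧ ≡ mkℚ (ℤ.+ k) 0 (Coprimality.sym (Coprimality.1-coprimeTo k))
⟦⟧≡mkℚ k = normalize-coprime (Coprimality.sym (Coprimality.1-coprimeTo k))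

⟦⟧-homo-+ : ∀ a b → ⟦ a ℕ.+ b ⟧ ≡ ⟦ a ⟧ + ⟦ b ⟧
⟦⟧-homo-+ a b rewrite ⟦⟧≡mkℚ a | ⟦⟧≡mkℚ b =
  sym (cong₂ (λ x y → (x ℤ.+ y) / 1) (ℤ.*-identityʳ (ℤ.+ a)) (ℤ.*-identityʳ (ℤ.+ b)))

⟦⟧-mono-≤ : a ℕ.≤ b → ⟦ a ⟧ ≤ ⟦ b ⟧
⟦⟧-mono-≤ {a} {b} a≤b rewrite ⟦⟧≡mkℚ a | ⟦⟧≡mkℚ b =
  *≤* (ℤ.*-monoʳ-≤-nonNeg (ℤ.+ 1) (ℤ.+≤+ a≤b))

⟦⟧-nonNeg : ∀ k → NonNegative ⟦ k ⟧
⟦⟧-nonNeg k = normalize-nonNeg k 1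

ρ*⟦d⟧≤⟦a⟧⇒ρ*⟦d+s⟧≤⟦a+s⟧ : ∀ d a s → ρ ≤ 1ℚ → ρ * ⟦ d ⟧ ≤ ⟦ a ⟧ → ρ * ⟦ d ℕ.+ s ⟧ ≤ ⟦ a ℕ.+ s ⟧
ρ*⟦d⟧≤⟦a⟧⇒ρ*⟦d+s⟧≤⟦a+s⟧ {ρ} d a s ρ≤1 ρd≤a = begin
  ρ * ⟦ d ℕ.+ s ⟧       ≡⟨ cong (ρ *_) (⟦⟧-homo-+ d s) ⟩
  ρ * (⟦ d ⟧ + ⟦ s ⟧)   ≡⟨ *-distribˡ-+ ρ ⟦ d ⟧ ⟦ s ⟧ ⟩
  ρ * ⟦ d ⟧ + ρ * ⟦ s ⟧ ≤⟨ +-monoˡ-≤ (ρ * ⟦ s ⟧) ρd≤a ⟩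
  ⟦ a ⟧ + ρ * ⟦ s ⟧     ≤⟨ +-monoʳ-≤ ⟦ a ⟧ (*-monoʳ-≤-nonNeg ⟦ s ⟧ {{⟦⟧-nonNeg s}} ρ≤1) ⟩
  ⟦ a ⟧ + 1ℚ * ⟦ s ⟧    ≡⟨ cong (⟦ a ⟧ +_) (*-identityˡ ⟦ s ⟧) ⟩
  ⟦ a ⟧ + ⟦ s ⟧         ≡⟨ sym (⟦⟧-homo-+ a s) ⟩
  ⟦ a ℕ.+ s ⟧           ∎
  where open ≤-Reasoning

∣p∩∁q∣+∣p∩q∣≡∣p∣ : ∀ (p q : Subset n) → ∣ p ∩ ∁ q ∣ ℕ.+ ∣ p ∩ q ∣ ≡ ∣ p ∣
∣p∩∁q∣+∣p∩q∣≡∣p∣ []            []            = refl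
∣p∩∁q∣+∣p∩q∣≡∣p∣ (outside ∷ p) (_ ∷ q)       = ∣p∩∁q∣+∣p∩q∣≡∣p∣ p q
∣p∩∁q∣+∣p∩q∣≡∣p∣ (inside  ∷ p) (outside ∷ q) = cong ℕ.suc (∣p∩∁q∣+∣p∩q∣≡∣p∣ p q)
∣p∩∁q∣+∣p∩q∣≡∣p∣ (inside  ∷ p) (inside  ∷ q) =
  trans (ℕ.+-suc _ _) (cong ℕ.suc (∣p∩∁q∣+∣p∩q∣≡∣p∣ p q))

∣p∩∁q∩r∣+∣p∩q∣≤∣p∩s∣ : ∀ (p q r s : Subset n) → r ∪ q ⊆ s →
                       ∣ p ∩ ∁ q ∩ r ∣ ℕ.+ ∣ p ∩ q ∣ ℕ.≤ ∣ p ∩ s ∣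
∣p∩∁q∩r∣+∣p∩q∣≤∣p∩s∣ p q r s r∪q⊆s = begin
  ∣ p ∩ ∁ q ∩ r ∣ ℕ.+ ∣ p ∩ q ∣         ≤⟨ ℕ.+-mono-≤ (p⊆q⇒∣p∣≤∣q∣ ∁q-part) (p⊆q⇒∣p∣≤∣q∣ q-part) ⟩
  ∣ (p ∩ s) ∩ ∁ q ∣ ℕ.+ ∣ (p ∩ s) ∩ q ∣ ≡⟨ ∣p∩∁q∣+∣p∩q∣≡∣p∣ (p ∩ s) q ⟩
  ∣ p ∩ s ∣                             ∎
  where
  open ℕ.≤-Reasoning
  ∁q-part : p ∩ ∁ q ∩ r ⊆ (p ∩ s) ∩ ∁ q
  ∁q-part x∈ with x∈p∩q⁻ p _ x∈
  ... | x∈p , x∈∁q∩r with x∈p∩q⁻ (∁ q) r x∈∁q∩r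
  ...   | x∈∁q , x∈r = x∈p∩q⁺ (x∈p∩q⁺ (x∈p , r∪q⊆s (x∈p∪q⁺ (inj₁ x∈r))) , x∈∁q)
  q-part : p ∩ q ⊆ (p ∩ s) ∩ q
  q-part x∈ with x∈p∩q⁻ p q x∈
  ... | x∈p , x∈q = x∈p∩q⁺ (x∈p∩q⁺ (x∈p , r∪q⊆s (x∈p∪q⁺ (inj₂ x∈q))) , x∈q)

if-inside-outside : ∀ b → (if b then inside else outside) ≡ b
if-inside-outside false = refl
if-inside-outside true  = refl

module _ (f : Fin n → Bool) where

  private
    χ : Subset n
    χ = tabulate (λ u → if f u then inside else outside)

    lookup-χ : ∀ v → lookup χ v ≡ f v
    lookup-χ v = trans (lookup∘tabulate _ v) (if-inside-outside (f v))

  ∈-tabulate⁻ : v ∈ χ → T (f v)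
  ∈-tabulate⁻ {v} v∈χ = Equivalence.from T-≡ (trans (sym (lookup-χ v)) ([]=⇒lookup v∈χ))

  ∈-tabulate⁺ : T (f v) → v ∈ χ
  ∈-tabulate⁺ {v} t = lookup⇒[]= v χ (trans (lookup-χ v) (Equivalence.to T-≡ t))

T-∈ᵇ∧≤ᵇ⇔∈×≤ : ∀ (W : Subset n) p q → T ((v ∈ᵇ W) ∧ (p ≤ᵇ q)) ⇔ (v ∈ W × p ≤ q)
T-∈ᵇ∧≤ᵇ⇔∈×≤ {v = v} W p q =
  mk⇔ (map toWitness ≤ᵇ⇒≤ ∘ Equivalence.to (T-∧ {v ∈ᵇ W}))
      (Equivalence.from (T-∧ {v ∈ᵇ W}) ∘ map fromWitness ≤⇒≤ᵇ)

Infectable : ℚ → Graph n → Subset n → Subset n → Fin n → Set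
Infectable ρ G W A v = v ∈ W × ρ * ⟦ degIn G W v ⟧ ≤ ⟦ ∣ N G v ∩ W ∩ A ∣ ⟧

-- The rational arguments below are passed explicitly: leaving them to unification
-- makes Agda unfold the normalisation hidden in ⟦_⟧, _*_ and _≤ᵇ_, which exhausts memory.
∈-step⁻ : v ∈ step ρ G W A → v ∈ A ⊎ Infectable ρ G W A v
∈-step⁻ {v = v} {ρ = ρ} {G = G} {W = W} {A = A} v∈ =
  map₂ (Equivalence.to (T-∈ᵇ∧≤ᵇ⇔∈×≤ W (ρ * ⟦ degIn G W v ⟧) ⟦ ∣ N G v ∩ W ∩ A ∣ ⟧) ∘ ∈-tabulate⁻ _)
       (x∈p∪q⁻ A _ v∈)

∈-step⁺ : Infectable ρ G W A v → v ∈ step ρ G W A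
∈-step⁺ {ρ = ρ} {G = G} {W = W} {A = A} {v = v} =
  q⊆p∪q A _ ∘ ∈-tabulate⁺ _ ∘ Equivalence.from (T-∈ᵇ∧≤ᵇ⇔∈×≤ W (ρ * ⟦ degIn G W v ⟧) ⟦ ∣ N G v ∩ W ∩ A ∣ ⟧)

module _ {ρ : ℚ} (G : Graph n) (S : Subset n) (ρ≤1 : ρ ≤ 1ℚ) where

  infectable-lift : A ∪ S ⊆ B → Infectable ρ G (∁ S) A v → Infectable ρ G ⊤ B v
  infectable-lift {A = A} {B = B} {v = v} A∪S⊆B (_ , reached) =
    ∈⊤ , (begin
      ρ * ⟦ degIn G ⊤ v ⟧                           ≡⟨ cong (λ d → ρ * ⟦ d ⟧) degree-split ⟩
      ρ * ⟦ degIn G (∁ S) v ℕ.+ ∣ N G v ∩ S ∣ ⟧     ≤⟨ ρ*⟦d⟧≤⟦a⟧⇒ρ*⟦d+s⟧≤⟦a+s⟧ (degIn G (∁ S) v)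
                                                        (∣ N G v ∩ ∁ S ∩ A ∣) (∣ N G v ∩ S ∣) ρ≤1 reached ⟩
      ⟦ ∣ N G v ∩ ∁ S ∩ A ∣ ℕ.+ ∣ N G v ∩ S ∣ ⟧     ≤⟨ ⟦⟧-mono-≤ neighbours-in-B ⟩
      ⟦ ∣ N G v ∩ ⊤ ∩ B ∣ ⟧                         ∎)
    where
    open ≤-Reasoning
    degree-split : degIn G ⊤ v ≡ degIn G (∁ S) v ℕ.+ ∣ N G v ∩ S ∣
    degree-split = trans (cong ∣_∣ (∩-identityʳ (N G v))) (sym (∣p∩∁q∣+∣p∩q∣≡∣p∣ (N G v) S))
    neighbours-in-B : ∣ N G v ∩ ∁ S ∩ A ∣ ℕ.+ ∣ N G v ∩ S ∣ ℕ.≤ ∣ N G v ∩ ⊤ ∩ B ∣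
    neighbours-in-B = ∣p∩∁q∩r∣+∣p∩q∣≤∣p∩s∣ (N G v) S A (⊤ ∩ B) (λ x∈ → x∈p∩q⁺ (∈⊤ , A∪S⊆B x∈))

  step-lift : A ∪ S ⊆ B → step ρ G (∁ S) A ∪ S ⊆ step ρ G ⊤ B
  step-lift {A = A} {B = B} A∪S⊆B {v} v∈ =
    [ [ already ∘ p⊆p∪q S , newly ]′ ∘ ∈-step⁻ {ρ = ρ} {G = G} {W = ∁ S} {A = A}
    , already ∘ q⊆p∪q A S
    ]′ (x∈p∪q⁻ _ S v∈)
    where
    already : A ∪ S ⊆ step ρ G ⊤ B
    already = p⊆p∪q _ ∘ A∪S⊆B
    newly : Infectable ρ G (∁ S) A v → v ∈ step ρ G ⊤ B
    newly = ∈-step⁺ {ρ = ρ} {G = G} {W = ⊤} {A = B} ∘ infectable-lift {A = A} {B = B} A∪S⊆B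

  infSeq-lift : ∀ i → infSeq ρ G (∁ S) A i ∪ S ⊆ infSeq ρ G ⊤ (A ∪ S) i
  infSeq-lift ℕ.zero    = id
  infSeq-lift (ℕ.suc i) = step-lift (infSeq-lift i)

proposition1 : ∀ {n} (ρ : ℚ) (G : Graph n) (S A : Subset n) →
    0ℚ ≤ ρ → ρ ≤ 1ℚ →
    A ⊆ ∁ S → Contagious ρ G (∁ S) A →
    ContagiousG ρ G (A ∪ S)
proposition1 ρ G S A _ ρ≤1 _ (i , ∁S⊆Aᵢ) = i , λ {v} _ → infSeq-lift G S ρ≤1 i (∈Aᵢ∪S v)
  where
  ∈Aᵢ∪S : ∀ v → v ∈ infSeq ρ G (∁ S) A i ∪ S
  ∈Aᵢ∪S v with v ∈? S
  ... | yes v∈S = q⊆p∪q _ S v∈S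
  ... | no  v∉S = p⊆p∪q S (∁S⊆Aᵢ (x∉p⇒x∈∁p v∉S))
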